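{- Let $r,k$ be integers with $k=r/2-1$ and $k\geq 2$. Then $\mathrm{tc}_{r,k}(K_n)\leq r-k$ for all $n\geq 1$.
   Context: For integers $r\geq k\geq 1$, an $(r,k)$-colouring of a graph $G$ is a function $\varphi:E(G)\to\binom{[r]}{k}$, assigning to each edge a set of exactly $k$ colours from $[r]=\{1,\dots,r\}$. A subgraph $H\subseteq G$ is monochromatic if there is a colour $i$ belonging to $\varphi(e)$ for every $e\in E(H)$. $\mathrm{tc}(G,\varphi)$ is the minimum number of monochromatic trees (a single vertex counts as a tree) whose union covers $V(G)$, and $\mathrm{tc}_{r,k}(G)$ is the minimum $m$ such that every $(r,k)$-colouring $\varphi$ of $G$ satisfies $\mathrm{tc}(G,\varphi)\leq m$. -}

module Defs where

open import Data.Nat using (ℕ; _<_; _≤_)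
open import Data.Fin using (Fin)
open import Data.Fin.Subset using (Subset; _∈_; ∣_∣)
open import Data.List using (List; length)
open import Data.List.Relation.Unary.Any using (Any)
open import Data.Product using (Σ; _×_)
open import Relation.Binary.PropositionalEquality using (_≡_; _≢_)

-- Represented as a symmetric function on ordered pairs; values on the
-- diagonal (u = v, not an edge) are irrelevant.
record Colouring (n r k : ℕ) : Set where
  field
    col  : Fin n → Fin n → Subset r
    sym  : ∀ u v → col u v ≡ col v u
    card : ∀ u v → u ≢ v → ∣ col u v ∣ ≡ k
open Colouring public

-- Presented as a rooted tree: every non-root vertex v of the tree
-- is joined to its parent `parent v` (also in the tree) by an edge carrying
-- colour `colour`; a strictly decreasing depth guarantees the edges
-- {v , parent v} form a tree (no cycles, connected to the root).
-- A single vertex is a tree.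
record MonoTree {n r k : ℕ} (φ : Colouring n r k) : Set where
  field
    colour    : Fin r
    verts     : Subset n
    root      : Fin n
    root∈     : root ∈ verts
    parent    : Fin n → Fin n
    depth     : Fin n → ℕ
    parent∈   : ∀ v → v ∈ verts → v ≢ root → parent v ∈ verts
    depth-dec : ∀ v → v ∈ verts → v ≢ root → depth (parent v) < depth v
    mono      : ∀ v → v ∈ verts → v ≢ root → colour ∈ col φ v (parent v)
open MonoTree public

TreeCoverAtMost : {n r k : ℕ} → Colouring n r k → ℕ → Set
TreeCoverAtMost {n} φ m =
  Σ (List (MonoTree φ)) λ ts →
    (length ts ≤ m) × (∀ (v : Fin n) → Any (λ t → v ∈ verts t) ts)

-- Split the 2k+2 colours into k+2 "low" and k "high" ones and fix a vertex v.
-- For a colour c, the vertices within distance 2 of v in colour c span a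
-- monochromatic tree.  If the k+2 low trees around v cover everything we are
-- done.  Otherwise some w lies in none of them; then the trees of the first
-- low colour c₀ around v and around w, together with the k high trees around
-- v, cover every vertex y.  Indeed, for an uncovered y the colour sets of the
-- edges vw, vy and wy are pairwise disjoint (vw carries only high colours,
-- vy only low ones, and a colour shared with wy would put y or w into a tree)
-- and all avoid c₀, so 3k ≤ 2k + 1, contradicting k ≥ 2.
module Submission where

open import Defs renaming (sym to col-sym)
open import Data.Bool using (Bool; true; false)
open import Function using (_∘_)
open import Data.Empty using (⊥; ⊥-elim)
open import Data.Fin using (Fin; zero; _↑ˡ_; _↑ʳ_; splitAt; cast)
open import Data.Fin.Properties using (_≟_; any?; all?; ¬∀⟶∃¬; splitAt⁻¹-↑ˡ; splitAt⁻¹-↑ʳ; cast-involutive)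
open import Data.Fin.Subset using (Subset; _∈_; _∉_; ∣_∣; _∪_; inside; outside)
open import Data.Fin.Subset.Properties using (_∈?_; x∈p∪q⁻; ∈⊤; ∣p∣≤n; ∣p∣≡n⇒p≡⊤)
open import Data.List using (_∷_; tabulate)
open import Data.List.Properties using (length-tabulate)
open import Data.List.Relation.Unary.Any as Any using (Any)
open import Data.List.Relation.Unary.Any.Properties using (tabulate⁺)
open import Data.Nat using (ℕ; suc; _+_; _*_; _∸_; _≤_; _<_; z<s; s<s)
open import Data.Nat.Properties using (+-suc; +-comm; +-identityʳ; +-monoʳ-≤; ≤-trans; ≤-reflexive; ≤∧≢⇒<; ≤⇒≯; m+n∸n≡m)
open import Data.Nat.Tactic.RingSolver using (solve-∀)
open import Data.Product using (∃; _×_; _,_; proj₁; proj₂; uncurry)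
open import Data.Sum using (_⊎_; inj₁; inj₂; [_,_])
open import Data.Vec using (_∷_; []; here; there) renaming (tabulate to tabulateᵛ)
open import Data.Vec.Properties using (lookup∘tabulate; lookup⇒[]=; []=⇒lookup)
open import Relation.Nullary using (¬_; Dec; yes; no; ¬?)
open import Relation.Nullary.Decidable using (_×-dec_)
open import Relation.Binary.PropositionalEquality using (_≡_; _≢_; refl; sym; trans; cong; subst)

Disjoint : ∀ {n} → Subset n → Subset n → Set
Disjoint p q = ∀ {x} → x ∈ p → x ∈ q → ⊥

drop-∷-disjoint : ∀ {n s t} {p q : Subset n} → Disjoint (s ∷ p) (t ∷ q) → Disjoint p q
drop-∷-disjoint d x∈p x∈q = d (there x∈p) (there x∈q)

∣p∪q∣≡∣p∣+∣q∣ : ∀ {n} {p q : Subset n} → Disjoint p q → ∣ p ∪ q ∣ ≡ ∣ p ∣ + ∣ q ∣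
∣p∪q∣≡∣p∣+∣q∣ {p = []}          {[]}          _ = refl
∣p∪q∣≡∣p∣+∣q∣ {p = inside  ∷ _} {inside  ∷ _} d = ⊥-elim (d here here)
∣p∪q∣≡∣p∣+∣q∣ {p = inside  ∷ _} {outside ∷ _} d =
  cong suc (∣p∪q∣≡∣p∣+∣q∣ (drop-∷-disjoint d))
∣p∪q∣≡∣p∣+∣q∣ {p = outside ∷ p} {inside  ∷ q} d =
  trans (cong suc (∣p∪q∣≡∣p∣+∣q∣ (drop-∷-disjoint d))) (sym (+-suc ∣ p ∣ ∣ q ∣))
∣p∪q∣≡∣p∣+∣q∣ {p = outside ∷ _} {outside ∷ _} d =
  ∣p∪q∣≡∣p∣+∣q∣ (drop-∷-disjoint d)

disjoint-∪ : ∀ {n} {p q s : Subset n} → Disjoint p q → Disjoint p s → Disjoint p (q ∪ s)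
disjoint-∪ {q = q} {s} pq ps x∈p x∈q∪s = [ pq x∈p , ps x∈p ] (x∈p∪q⁻ q s x∈q∪s)

x∉p⇒∣p∣<n : ∀ {n x} {p : Subset n} → x ∉ p → ∣ p ∣ < n
x∉p⇒∣p∣<n {p = p} x∉p = ≤∧≢⇒< (∣p∣≤n p) (λ ∣p∣≡n → x∉p (subst (_ ∈_) (sym (∣p∣≡n⇒p≡⊤ ∣p∣≡n)) ∈⊤))

disjoint³-avoiding-bound : ∀ {n x} {p q s : Subset n} →
  Disjoint p q → Disjoint p s → Disjoint q s → x ∉ p → x ∉ q → x ∉ s →
  ∣ p ∣ + (∣ q ∣ + ∣ s ∣) < n
disjoint³-avoiding-bound {p = p} {q} {s} pq ps qs x∉p x∉q x∉s =
  subst (_< _) size (x∉p⇒∣p∣<n {p = p ∪ q ∪ s} avoid)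
  where
  size : ∣ p ∪ q ∪ s ∣ ≡ ∣ p ∣ + (∣ q ∣ + ∣ s ∣)
  size = trans (∣p∪q∣≡∣p∣+∣q∣ (disjoint-∪ pq ps))
               (cong (∣ p ∣ +_) (∣p∪q∣≡∣p∣+∣q∣ qs))
  avoid : _ ∉ p ∪ q ∪ s
  avoid m = [ x∉p , [ x∉q , x∉s ] ∘ x∈p∪q⁻ q s ] (x∈p∪q⁻ p (q ∪ s) m)

module Balls {n r k : ℕ} (φ : Colouring n r k) where

  Edge : Fin r → Fin n → Fin n → Set
  Edge c x y = x ≢ y × c ∈ col φ x y

  edge? : ∀ c x y → Dec (Edge c x y)
  edge? c x y = ¬? (x ≟ y) ×-dec (c ∈? col φ x y)

  edge-sym : ∀ {c x y} → Edge c x y → Edge c y x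
  edge-sym {c} {x} {y} (x≢y , c∈xy) = (x≢y ∘ sym) , subst (c ∈_) (col-sym φ x y) c∈xy

  data Position (c : Fin r) (v x : Fin n) : Set where
    centre  : x ≡ v → Position c v x
    near    : Edge c v x → Position c v x
    far     : x ≢ v → ¬ Edge c v x → ∀ y → Edge c v y → Edge c y x → Position c v x
    outside : x ≢ v → ¬ Edge c v x → (∀ y → Edge c v y → ¬ Edge c y x) → Position c v x

  position : ∀ c v x → Position c v x
  position c v x with x ≟ v | edge? c v x | any? (λ y → edge? c v y ×-dec edge? c y x)
  ... | yes x≡v | _      | _                 = centre x≡v
  ... | no x≢v  | yes vx | _                 = near vx
  ... | no x≢v  | no ¬vx | yes (y , vy , yx) = far x≢v ¬vx y vy yx
  ... | no x≢v  | no ¬vx | no ¬path          = outside x≢v ¬vx (λ y vy yx → ¬path (y , vy , yx))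

  module _ {c : Fin r} {v x : Fin n} where

    inBall : Position c v x → Bool
    inBall (outside _ _ _) = false
    inBall _               = true

    parentOf : Position c v x → Fin n
    parentOf (far _ _ y _ _) = y
    parentOf _               = v

    depthOf : Position c v x → ℕ
    depthOf (centre _)      = 0
    depthOf (near _)        = 1
    depthOf (far _ _ _ _ _) = 2
    depthOf (outside _ _ _) = 0

  ballVerts : Fin r → Fin n → Subset n
  ballVerts c v = tabulateᵛ (λ x → inBall (position c v x))

  module _ {c : Fin r} {v : Fin n} where

    ∈ballVerts⁺ : ∀ {x} → inBall (position c v x) ≡ true → x ∈ ballVerts c v
    ∈ballVerts⁺ {x} e = lookup⇒[]= x (ballVerts c v) (trans (lookup∘tabulate _ x) e)

    ∈ballVerts⁻ : ∀ {x} → x ∈ ballVerts c v → inBall (position c v x) ≡ true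
    ∈ballVerts⁻ {x} x∈ = trans (sym (lookup∘tabulate _ x)) ([]=⇒lookup x∈)

    within₂⇒∈ballVerts : ∀ {x} → x ≡ v ⊎ Edge c v x ⊎ (∃ λ y → Edge c v y × Edge c y x) → x ∈ ballVerts c v
    within₂⇒∈ballVerts {x} within = ∈ballVerts⁺ (in-ball (position c v x))
      where
      in-ball : (p : Position c v x) → inBall p ≡ true
      in-ball (centre _)              = refl
      in-ball (near _)                = refl
      in-ball (far _ _ _ _ _)         = refl
      in-ball (outside x≢v ¬vx ¬path) =
        ⊥-elim ([ x≢v , [ ¬vx , (λ { (y , vy , yx) → ¬path y vy yx }) ] ] within)

    centre∈ballVerts : v ∈ ballVerts c v
    centre∈ballVerts = within₂⇒∈ballVerts (inj₁ refl)

    edge∈ballVerts : ∀ {x} → Edge c v x → x ∈ ballVerts c v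
    edge∈ballVerts vx = within₂⇒∈ballVerts (inj₂ (inj₁ vx))

    path∈ballVerts : ∀ {x y} → Edge c v y → Edge c y x → x ∈ ballVerts c v
    path∈ballVerts vy yx = within₂⇒∈ballVerts (inj₂ (inj₂ (_ , vy , yx)))

    ∉ballVerts⇒≢ : ∀ {x} → x ∉ ballVerts c v → v ≢ x
    ∉ballVerts⇒≢ x∉ refl = x∉ centre∈ballVerts

    depth-centre : depthOf (position c v v) ≡ 0
    depth-centre with position c v v
    ... | centre _        = refl
    ... | near (v≢v , _)  = ⊥-elim (v≢v refl)
    ... | far v≢v _ _ _ _ = ⊥-elim (v≢v refl)
    ... | outside v≢v _ _ = ⊥-elim (v≢v refl)

    depth-near : ∀ {y} → Edge c v y → depthOf (position c v y) ≡ 1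
    depth-near {y} vy with position c v y
    ... | centre refl     = ⊥-elim (proj₁ vy refl)
    ... | near _          = refl
    ... | far _ ¬vy _ _ _ = ⊥-elim (¬vy vy)
    ... | outside _ ¬vy _ = ⊥-elim (¬vy vy)

  ball : Fin r → Fin n → MonoTree φ
  ball c v = record
    { colour    = c
    ; verts     = ballVerts c v
    ; root      = v
    ; root∈     = centre∈ballVerts
    ; parent    = λ x → parentOf (position c v x)
    ; depth     = λ x → depthOf (position c v x)
    ; parent∈   = parent-in-ball
    ; depth-dec = depth-drops
    ; mono      = parent-edge
    }
    where
    -- Abstracting position c v x also in the type of ∈ballVerts⁻ x∈ turns it
    -- into false ≡ true for outside vertices.
    parent-in-ball : ∀ x → x ∈ ballVerts c v → x ≢ v → parentOf (position c v x) ∈ ballVerts c v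
    parent-in-ball x x∈ x≢v with position c v x | ∈ballVerts⁻ x∈
    ... | centre x≡v        | _ = ⊥-elim (x≢v x≡v)
    ... | near _            | _ = centre∈ballVerts
    ... | far _ _ _ vy _    | _ = edge∈ballVerts vy
    ... | outside _ _ _     | ()

    depth-drops : ∀ x → x ∈ ballVerts c v → x ≢ v →
      depthOf (position c v (parentOf (position c v x))) < depthOf (position c v x)
    depth-drops x x∈ x≢v with position c v x | ∈ballVerts⁻ x∈
    ... | centre x≡v        | _ = ⊥-elim (x≢v x≡v)
    ... | near _            | _ = subst (_< 1) (sym depth-centre) z<s
    ... | far _ _ _ vy _    | _ = subst (_< 2) (sym (depth-near vy)) (s<s z<s)
    ... | outside _ _ _     | ()

    parent-edge : ∀ x → x ∈ ballVerts c v → x ≢ v → c ∈ col φ x (parentOf (position c v x))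
    parent-edge x x∈ x≢v with position c v x | ∈ballVerts⁻ x∈
    ... | centre x≡v        | _ = ⊥-elim (x≢v x≡v)
    ... | near vx           | _ = proj₂ (edge-sym vx)
    ... | far _ _ _ _ yx    | _ = proj₂ (edge-sym yx)
    ... | outside _ _ _     | ()

module LowHighCover {n r k a b : ℕ} (φ : Colouring n r k)
  (low : Fin (suc a) → Fin r) (high : Fin b → Fin r)
  (low-or-high : ∀ c → (∃ λ i → low i ≡ c) ⊎ (∃ λ j → high j ≡ c)) where

  open Balls φ

  c₀ : Fin r
  c₀ = low zero

  InLowBall : Fin n → Fin n → Set
  InLowBall v x = ∃ λ i → x ∈ ballVerts (low i) v

  inLowBall? : ∀ v x → Dec (InLowBall v x)
  inLowBall? v x = any? (λ i → x ∈? ballVerts (low i) v)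

  InHighBall : Fin n → Fin n → Set
  InHighBall v x = ∃ λ j → x ∈ ballVerts (high j) v

  uncovered⇒3k<r : ∀ {v w y} → ¬ InLowBall v w →
    y ∉ ballVerts c₀ v → y ∉ ballVerts c₀ w → ¬ InHighBall v y → 3 * k < r
  uncovered⇒3k<r {v} {w} {y} w-far y∉v y∉w y-far =
    subst (_< r) sizes (disjoint³-avoiding-bound vw#vy vw#wy vy#wy
      (λ c₀∈vw → w-far (zero , edge∈ballVerts (v≢w , c₀∈vw)))
      (λ c₀∈vy → y∉v (edge∈ballVerts (v≢y , c₀∈vy)))
      (λ c₀∈wy → y∉w (edge∈ballVerts (w≢y , c₀∈wy))))
    where
    v≢w = ∉ballVerts⇒≢ (λ w∈ → w-far (zero , w∈))
    v≢y = ∉ballVerts⇒≢ y∉v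
    w≢y = ∉ballVerts⇒≢ y∉w

    sizes : ∣ col φ v w ∣ + (∣ col φ v y ∣ + ∣ col φ w y ∣) ≡ 3 * k
    sizes rewrite card φ v w v≢w | card φ v y v≢y | card φ w y w≢y | +-identityʳ k = refl

    neither : ∀ c → (∀ i → low i ≡ c → ⊥) → (∀ j → high j ≡ c → ⊥) → ⊥
    neither c ¬low ¬high = [ (λ { (i , e) → ¬low i e }) , (λ { (j , e) → ¬high j e }) ] (low-or-high c)

    vw#vy : Disjoint (col φ v w) (col φ v y)
    vw#vy {c} c∈vw c∈vy = neither c
      (λ { i refl → w-far (i , edge∈ballVerts (v≢w , c∈vw)) })
      (λ { j refl → y-far (j , edge∈ballVerts (v≢y , c∈vy)) })

    vw#wy : Disjoint (col φ v w) (col φ w y)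
    vw#wy {c} c∈vw c∈wy = neither c
      (λ { i refl → w-far (i , edge∈ballVerts (v≢w , c∈vw)) })
      (λ { j refl → y-far (j , path∈ballVerts (v≢w , c∈vw) (w≢y , c∈wy)) })

    vy#wy : Disjoint (col φ v y) (col φ w y)
    vy#wy {c} c∈vy c∈wy = neither c
      (λ { i refl → w-far (i , path∈ballVerts (v≢y , c∈vy) (edge-sym (w≢y , c∈wy))) })
      (λ { j refl → y-far (j , edge∈ballVerts (v≢y , c∈vy)) })

  lowBall : Fin n → Fin (suc a) → MonoTree φ
  lowBall v i = ball (low i) v

  highBall : Fin n → Fin b → MonoTree φ
  highBall v j = ball (high j) v

  module _ {m : ℕ} (v : Fin n) where

    lowBalls-cover : suc a ≤ m → (∀ x → InLowBall v x) → TreeCoverAtMost φ m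
    lowBalls-cover a<m covered =
      tabulate (lowBall v) ,
      subst (_≤ m) (sym (length-tabulate (lowBall v))) a<m ,
      λ x → tabulate⁺ {f = lowBall v} (proj₁ (covered x)) (proj₂ (covered x))

    twoCentres-cover : r ≤ 3 * k → 2 + b ≤ m → ∀ w → ¬ InLowBall v w → TreeCoverAtMost φ m
    twoCentres-cover r≤3k 2+b≤m w w-far =
      ball c₀ v ∷ ball c₀ w ∷ tabulate (highBall v) ,
      subst (λ l → 2 + l ≤ m) (sym (length-tabulate (highBall v))) 2+b≤m ,
      cover
      where
      cover : ∀ y → Any (λ t → y ∈ verts t) (ball c₀ v ∷ ball c₀ w ∷ tabulate (highBall v))
      cover y with y ∈? ballVerts c₀ v | y ∈? ballVerts c₀ w | any? (λ j → y ∈? ballVerts (high j) v)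
      ... | yes y∈ | _      | _            = Any.here y∈
      ... | no _   | yes y∈ | _            = Any.there (Any.here y∈)
      ... | no _   | no _   | yes (j , y∈) = Any.there (Any.there (tabulate⁺ {f = highBall v} j y∈))
      ... | no y∉v | no y∉w | no y-far     = ⊥-elim (≤⇒≯ r≤3k (uncovered⇒3k<r w-far y∉v y∉w y-far))

    r≤3k⇒treeCover : r ≤ 3 * k → suc a ≤ m → 2 + b ≤ m → TreeCoverAtMost φ m
    r≤3k⇒treeCover r≤3k a<m 2+b≤m with all? (inLowBall? v)
    ... | yes covered = lowBalls-cover a<m covered
    ... | no ¬covered = uncurry (twoCentres-cover r≤3k 2+b≤m) (¬∀⟶∃¬ n _ (inLowBall? v) ¬covered)

↑ˡ-or-↑ʳ : ∀ {a b r} (a+b≡r : a + b ≡ r) (c : Fin r) →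
  (∃ λ i → cast a+b≡r (i ↑ˡ b) ≡ c) ⊎ (∃ λ j → cast a+b≡r (a ↑ʳ j) ≡ c)
↑ˡ-or-↑ʳ {a} a+b≡r c with splitAt a (cast (sym a+b≡r) c) in split≡
... | inj₁ i = inj₁ (i , trans (cong (cast a+b≡r) (splitAt⁻¹-↑ˡ split≡)) (cast-involutive a+b≡r (sym a+b≡r) c))
... | inj₂ j = inj₂ (j , trans (cong (cast a+b≡r) (splitAt⁻¹-↑ʳ split≡)) (cast-involutive a+b≡r (sym a+b≡r) c))

lemma5p4 : (r k : ℕ) → 2 * k + 2 ≡ r → 2 ≤ k →
    (n : ℕ) → 1 ≤ n → (φ : Colouring n r k) → TreeCoverAtMost φ (r ∸ k)
lemma5p4 r k 2k+2≡r 2≤k 0 () φ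
lemma5p4 r k 2k+2≡r 2≤k (suc n) _ φ =
  r≤3k⇒treeCover zero r≤3k (≤-reflexive (sym r∸k≡2+k)) (≤-reflexive (sym r∸k≡2+k))
  where
  2+k+k≡r : 2 + k + k ≡ r
  2+k+k≡r = trans (2+k+k≡2*k+2 k) 2k+2≡r
    where
    2+k+k≡2*k+2 : ∀ k → 2 + k + k ≡ 2 * k + 2
    2+k+k≡2*k+2 = solve-∀

  open LowHighCover φ (λ i → cast 2+k+k≡r (i ↑ˡ k)) (λ j → cast 2+k+k≡r ((2 + k) ↑ʳ j)) (↑ˡ-or-↑ʳ 2+k+k≡r)

  r≤3k : r ≤ 3 * k
  r≤3k = subst (_≤ 3 * k) 2k+2≡r (≤-trans (+-monoʳ-≤ (2 * k) 2≤k) (≤-reflexive (+-comm (2 * k) k)))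

  r∸k≡2+k : r ∸ k ≡ 2 + k
  r∸k≡2+k = trans (cong (_∸ k) (sym 2+k+k≡r)) (m+n∸n≡m (2 + k) k)
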